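{- For any closed aggregate expression $E$ and any list $\mathbf X$ of distinct variables containing all variables that occur in $E$, the infinitary formula $\tau E$ is satisfied by exactly the same interpretations of the vocabulary of $E$ as the formula $\phi^{\mathbf X}E$.
   Context: Terms are built from numerals $\overline n$ ($n\in\mathbb Z$), symbolic constants, variables, the symbols $\mathit{inf},\mathit{sup}$, $f(\mathbf t)$ ($f$ a symbolic constant), $\mathit{op}(\mathbf t)$ (each $n$-ary operation name has a function $\widehat{\mathit{op}}$ from a subset of $\mathbb Z^n$ to $\mathbb Z$), and intervals $(t_1..t_2)$. Ground = variable-free; precomputed = ground without operation names or intervals. A total order on precomputed terms ($\mathit{inf}$ least, $\mathit{sup}$ greatest, numerals ordered as integers) interprets $=,\neq,<,>,\le,\ge$. Values $[t]$ of ground terms: $\{t\}$ for numerals, symbolic constants, $\mathit{inf},\mathit{sup}$; $[f(t_1,..,t_n)]=\{f(r_1,..,r_n):r_i\in[t_i]\}$; $[\mathit{op}(t_1,..,t_n)]=\{\overline{\widehat{\mathit{op}}(k_1,..,k_n)}:(k_i)\in\mathrm{dom}\,\widehat{\mathit{op}},\overline{k_i}\in[t_i]\}$; $[(t_1..t_2)]=\{\overline m:k_1\le m\le k_2,\overline{k_1}\in[t_1],\overline{k_2}\in[t_2]\}$; $[t_1,..,t_n]$ = tuples of values. Literals: atoms $p(\mathbf t)$ or $\mathit{not}\ p(\mathbf t)$; comparisons $(t_1\prec t_2)$. Each aggregate name $\alpha$ has a function $\widehat\alpha$ from sets of non-empty tuples of precomputed terms to precomputed terms. An aggregate expression is $\alpha\{\mathbf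 t:\mathbf C\}\prec s$ ($\mathbf t$ non-empty tuple of terms, $\mathbf C$ a conjunction of literals and comparisons, $s$ a variable or precomputed term); it is closed if $s$ is ground. Its vocabulary is the set of atoms $p(\mathbf r)$, $\mathbf r$ an $n$-tuple of precomputed terms, such that it contains an atom $p(t_1,\dots,t_n)$. Interpretations are sets of atoms $p(\mathbf r)$ with precomputed $\mathbf r$. Formulas and arguments (mutually recursive): formulas $p(\mathbf{arg})$, $\mathit{arg}_1\prec\mathit{arg}_2$, $\mathit{arg}\in t$ ($t$ a term), $\bot$, $F\to G$, $\forall XF$; arguments are numerals, symbolic constants, variables, $\mathit{inf},\mathit{sup}$, $f(\mathbf{arg})$, and $\alpha\{\mathbf X\mid F\}$ ($\mathbf X$ non-empty tuple of distinct variables, bound in it). Semantics under $\mathcal I$: atoms true iff (with arguments evaluated) in $\mathcal I$; $\prec$ via the order; $\mathit{arg}\in t$ true iff $\mathit{arg}^{\mathcal I}\in[t]$; classical connectives; $\forall$ ranges over precomputed terms; $\alpha\{X_1..X_k\mid F\}^{\mathcal I}=\widehat\alpha(T)$ with $T$ the set of tuples $r_1..r_k$ of precomputed terms such that $F^{X_1..X_k}_{r_1..r_k}$ is true. $\phi p(\mathbf t)=\exists\mathbf X(\mathbf X\in\mathbf t\wedge p(\mathbf X))$, $\phi(\mathit{not}\ p(\mathbf t))=\exists\mathbf X(\mathbf X\in\mathbf t\wedge\neg p(\mathbf X))$, $\phi(t_1\prec t_2)=\exists X_1X_2(X_1\in t_1\wedge X_2\in t_2\wedge X_1\prec X_2)$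 (new variables), conjunct-wise on conjunctions. $\phi^{\mathbf X}(\alpha\{\mathbf t:\mathbf C\}\prec s)=\exists Y(\alpha\{\mathbf Z\mid\exists\mathbf X(\mathbf Z\in\mathbf t\wedge\phi\mathbf C)\}\prec Y\wedge Y\in s)$ with new $\mathbf Z,Y$. Infinitary formulas: atoms, $\bot$, $\mathcal H^\wedge$, $\mathcal H^\vee$ for arbitrary sets $\mathcal H$, $G\to H$, with classical satisfaction; $\neg F=F\to\bot$, $\top=\neg\bot$. $\tau p(\mathbf t)=\bigvee_{\mathbf r\in[\mathbf t]}p(\mathbf r)$, $\tau(\mathit{not}\ p(\mathbf t))=\bigvee_{\mathbf r\in[\mathbf t]}\neg p(\mathbf r)$; $\tau(t_1\prec t_2)$ is $\top$ if $r_1\prec r_2$ for some $r_i\in[t_i]$, else $\bot$; conjunct-wise on conjunctions. For a closed aggregate expression $E=\alpha\{\mathbf t:\mathbf C\}\prec s$, let $\mathbf Y$ list the variables occurring in $E$, $A$ the set of tuples of precomputed terms of length $|\mathbf Y|$, and for $\Delta\subseteq A$, $[\Delta]=\bigcup_{\mathbf r\in\Delta}[\mathbf t^{\mathbf Y}_{\mathbf r}]$; $\Delta$ justifies $E$ if $\widehat\alpha([\Delta])\prec s$. Then $\tau E$ is the conjunction over all $\Delta\subseteq A$ not justifying $E$ of $\bigwedge_{\mathbf r\in\Delta}\tau(\mathbf C^{\mathbf Y}_{\mathbf r})\to\bigvee_{\mathbf r\in A\setminus\Delta}\tau(\mathbf C^{\mathbf Y}_{\mathbf r})$. -}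

module Defs where

open import Level using (Level; 0ℓ; Lift; lift) renaming (suc to lsuc)
open import Data.Bool using (if_then_else_)
open import Data.Nat as ℕ using (ℕ; zero; suc; _+_; _⊔_; _≡ᵇ_)
open import Data.Nat.Properties using (_≟_)
open import Data.Integer as ℤ using (ℤ)
open import Data.List as List using (List; []; _∷_; length; _++_; concatMap; deduplicate; applyUpTo)
open import Data.List.NonEmpty as List⁺ using (List⁺; _∷_; toList)
open import Data.Vec as Vec using (Vec)
open import Data.Maybe using (Maybe; just; nothing)
open import Data.Product using (Σ; _×_; _,_)
open import Data.Sum using (_⊎_)
open import Data.Empty using (⊥)
open import Data.Unit using (⊤)
open import Data.Fin using (Fin)
open import Relation.Binary.PropositionalEquality using (_≡_; _≢_)
open import Relation.Nullary using (¬_)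
open import Relation.Binary.Structures using (IsStrictTotalOrder)
open import Data.List.Membership.Propositional using (_∈_)
open import Function.Bundles using (_⇔_)

Var : Set
Var = ℕ

-- The syntactic vocabulary: symbolic constants (also used as function
-- symbols f), predicate symbols, operation names, aggregate names.

record Lang : Set₁ where
  field
    Sym Pred Op AggName : Set

data Cmp : Set where
  eq neq lt gt le ge : Cmp

module _ (L : Lang) where
  open Lang L

  data PTerm : Set where
    num : ℤ → PTerm
    sym : Sym → PTerm
    inf sup : PTerm
    app : Sym → List PTerm → PTerm

  data Term : Set where
    num : ℤ → Term
    sym : Sym → Term
    var : Var → Term
    inf sup : Term
    app : Sym → List Term → Term
    op : Op → List Term → Term
    interval : Term → Term → Term

  data Literal : Set where
    pos : Pred → List Term → Literal
    neg : Pred → List Term → Literal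
    cmp : Term → Cmp → Term → Literal

  data RHS : Set where
    rvar : Var → RHS
    rpre : PTerm → RHS

  record AggExpr : Set where
    constructor aggExpr
    field
      α    : AggName
      head : List⁺ Term
      cond : List Literal
      rel  : Cmp
      rhs  : RHS

  -- closed: s is ground, i.e. a precomputed term
  Closed : AggExpr → Set
  Closed E = Σ PTerm λ s → AggExpr.rhs E ≡ rpre s

  mutual
    data Arg : Set where
      num : ℤ → Arg
      sym : Sym → Arg
      var : Var → Arg
      inf sup : Arg
      app : Sym → List Arg → Arg
      agg : AggName → List⁺ Var → Formula → Arg

    data Formula : Set where
      atom : Pred → List Arg → Formula
      cmp : Arg → Cmp → Arg → Formula
      mem : Arg → Term → Formula
      ⊥ᶠ : Formula
      _⇒_ : Formula → Formula → Formula
      all : Var → Formula → Formula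

  infixr 4 _⇒_

  Atom : Set
  Atom = Pred × List PTerm

  data Inf : Set₂ where
    atom : Atom → Inf
    ⊥∞ : Inf
    ⋀ ⋁ : (J : Set₁) → (J → Inf) → Inf
    _⊃_ : Inf → Inf → Inf

  infixr 4 _⊃_

  Interp : Set₁
  Interp = Atom → Set

  mutual
    varsTerm : Term → List Var
    varsTerm (var x) = x ∷ []
    varsTerm (app f ts) = varsTerms ts
    varsTerm (op o ts) = varsTerms ts
    varsTerm (interval t₁ t₂) = varsTerm t₁ ++ varsTerm t₂
    varsTerm _ = []

    varsTerms : List Term → List Var
    varsTerms [] = []
    varsTerms (t ∷ ts) = varsTerm t ++ varsTerms ts

  varsLit : Literal → List Var
  varsLit (pos p ts) = varsTerms ts
  varsLit (neg p ts) = varsTerms ts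
  varsLit (cmp t₁ R t₂) = varsTerm t₁ ++ varsTerm t₂

  varsRHS : RHS → List Var
  varsRHS (rvar x) = x ∷ []
  varsRHS (rpre _) = []

  varsE : AggExpr → List Var
  varsE E = deduplicate _≟_
    (varsTerms (toList (AggExpr.head E)) ++ concatMap varsLit (AggExpr.cond E)
      ++ varsRHS (AggExpr.rhs E))

  InVoc : AggExpr → Atom → Set
  InVoc E (p , rs) = Σ (List Term) λ ts →
    (pos p ts ∈ AggExpr.cond E ⊎ neg p ts ∈ AggExpr.cond E) × length ts ≡ length rs

  mutual
    ⌜_⌝ : PTerm → Term
    ⌜ num n ⌝ = num n
    ⌜ sym c ⌝ = sym c
    ⌜ inf ⌝ = inf
    ⌜ sup ⌝ = sup
    ⌜ app f rs ⌝ = app f ⌜ rs ⌝*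

    ⌜_⌝* : List PTerm → List Term
    ⌜ [] ⌝* = []
    ⌜ r ∷ rs ⌝* = ⌜ r ⌝ ∷ ⌜ rs ⌝*

  mutual
    substT : (Var → Maybe PTerm) → Term → Term
    substT σ (var x) with σ x
    ... | just r = ⌜ r ⌝
    ... | nothing = var x
    substT σ (num n) = num n
    substT σ (sym c) = sym c
    substT σ inf = inf
    substT σ sup = sup
    substT σ (app f ts) = app f (substTs σ ts)
    substT σ (op o ts) = op o (substTs σ ts)
    substT σ (interval t₁ t₂) = interval (substT σ t₁) (substT σ t₂)

    substTs : (Var → Maybe PTerm) → List Term → List Term
    substTs σ [] = []
    substTs σ (t ∷ ts) = substT σ t ∷ substTs σ ts

  substLit : (Var → Maybe PTerm) → Literal → Literal
  substLit σ (pos p ts) = pos p (substTs σ ts)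
  substLit σ (neg p ts) = neg p (substTs σ ts)
  substLit σ (cmp t₁ R t₂) = cmp (substT σ t₁) R (substT σ t₂)

  assign : List Var → List PTerm → Var → Maybe PTerm
  assign (y ∷ ys) (r ∷ rs) x = if x ≡ᵇ y then just r else assign ys rs x
  assign _ _ x = nothing

  Env : Set
  Env = Var → PTerm

  update : Env → List Var → List PTerm → Env
  update ρ (z ∷ zs) (r ∷ rs) x = if x ≡ᵇ z then r else update ρ zs rs x
  update ρ _ _ x = ρ x

  infix 6 ¬ᶠ_
  infixr 5 _∧ᶠ_
  ¬ᶠ_ : Formula → Formula
  ¬ᶠ F = F ⇒ ⊥ᶠ

  ⊤ᶠ : Formula
  ⊤ᶠ = ¬ᶠ ⊥ᶠ

  _∧ᶠ_ : Formula → Formula → Formula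
  F ∧ᶠ G = ¬ᶠ (F ⇒ ¬ᶠ G)

  ∃ᶠ : Var → Formula → Formula
  ∃ᶠ x F = ¬ᶠ all x (¬ᶠ F)

  ∃* : List Var → Formula → Formula
  ∃* [] F = F
  ∃* (x ∷ xs) F = ∃ᶠ x (∃* xs F)

  ⋀ᶠ : List Formula → Formula
  ⋀ᶠ [] = ⊤ᶠ
  ⋀ᶠ (F ∷ []) = F
  ⋀ᶠ (F ∷ Fs@(_ ∷ _)) = F ∧ᶠ ⋀ᶠ Fs

  memT : List Var → List Term → Formula
  memT xs ts = ⋀ᶠ (List.zipWith (λ x t → mem (var x) t) xs ts)

  range : ℕ → ℕ → List Var
  range b n = applyUpTo (b +_) n

  -- φ on a literal; b is the first index of the block of new variables
  φLit : ℕ → Literal → Formula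
  φLit b (pos p ts) = let Xs = range b (length ts) in
    ∃* Xs (memT Xs ts ∧ᶠ atom p (List.map var Xs))
  φLit b (neg p ts) = let Xs = range b (length ts) in
    ∃* Xs (memT Xs ts ∧ᶠ ¬ᶠ atom p (List.map var Xs))
  φLit b (cmp t₁ R t₂) = ∃* (b ∷ suc b ∷ [])
    (mem (var b) t₁ ∧ᶠ (mem (var (suc b)) t₂ ∧ᶠ cmp (var b) R (var (suc b))))

  φConj : ℕ → List Literal → Formula
  φConj b C = ⋀ᶠ (List.map (φLit b) C)

  rhsTerm : RHS → Term
  rhsTerm (rvar x) = var x
  rhsTerm (rpre s) = ⌜ s ⌝

  -- φ^X E, the new variables being chosen above all variables of X and E
  φAgg : List Var → AggExpr → Formula
  φAgg X E =
    ∃ᶠ Y (cmp (agg α Zs (∃* X (memT (toList Zs) (toList head) ∧ᶠ φConj b cond))) rel (var Y)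
          ∧ᶠ mem (var Y) (rhsTerm rhs))
    where
      open AggExpr E
      N : ℕ
      N = suc (List.foldr _⊔_ 0 (X ++ varsE E))
      k : ℕ
      k = List⁺.length head
      Zs : List⁺ Var
      Zs = N ∷ range (suc N) (List.length (List⁺.tail head))
      Y : Var
      Y = N + k
      b : ℕ
      b = suc Y

-- Semantic parameters: operations, the total order on precomputed terms,
-- and aggregate functions (on sets of non-empty tuples, represented as
-- predicates; a function on sets must respect extensional equality).

record Sem (L : Lang) : Set₁ where
  open Lang L
  field
    arity : Op → ℕ
    opFun : (o : Op) → Vec ℤ (arity o) → Maybe ℤ
    _<ₚ_ : PTerm L → PTerm L → Set
    isSTO : IsStrictTotalOrder _≡_ _<ₚ_
    inf-least : ∀ r → r ≢ inf → inf <ₚ r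
    sup-greatest : ∀ r → r ≢ sup → r <ₚ sup
    num-order : ∀ m n → (num m <ₚ num n) ⇔ (m ℤ.< n)
    aggFun : AggName → (List⁺ (PTerm L) → Set) → PTerm L
    aggFun-ext : ∀ α P Q → (∀ r → P r ⇔ Q r) → aggFun α P ≡ aggFun α Q

module _ {L : Lang} (M : Sem L) where
  open Lang L
  open Sem M

  Holds : Cmp → PTerm L → PTerm L → Set
  Holds eq a b = a ≡ b
  Holds neq a b = a ≢ b
  Holds lt a b = a <ₚ b
  Holds gt a b = b <ₚ a
  Holds le a b = a <ₚ b ⊎ a ≡ b
  Holds ge a b = b <ₚ a ⊎ a ≡ b

  -- values [t] (meaningful for ground t) as predicates on precomputed terms
  mutual
    Val : Term L → PTerm L → Set
    Val (num n) r = r ≡ num n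
    Val (sym c) r = r ≡ sym c
    Val (var x) r = ⊥
    Val inf r = r ≡ inf
    Val sup r = r ≡ sup
    Val (app f ts) r = Σ (List (PTerm L)) λ rs → ValList ts rs × r ≡ app f rs
    Val (op o ts) r = Σ (Vec ℤ (arity o)) λ ks →
      ValList ts (List.map num (Vec.toList ks)) × Σ ℤ λ k → opFun o ks ≡ just k × r ≡ num k
    Val (interval t₁ t₂) r = Σ ℤ λ k₁ → Σ ℤ λ k₂ → Σ ℤ λ m →
      Val t₁ (num k₁) × Val t₂ (num k₂) × k₁ ℤ.≤ m × m ℤ.≤ k₂ × r ≡ num m

    ValList : List (Term L) → List (PTerm L) → Set
    ValList [] [] = ⊤
    ValList (t ∷ ts) (r ∷ rs) = Val t r × ValList ts rs
    ValList _ _ = ⊥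

  mutual
    evalArg : Interp L → Env L → Arg L → PTerm L
    evalArg I ρ (num n) = num n
    evalArg I ρ (sym c) = sym c
    evalArg I ρ (var x) = ρ x
    evalArg I ρ inf = inf
    evalArg I ρ sup = sup
    evalArg I ρ (app f as) = app f (evalArgs I ρ as)
    evalArg I ρ (agg α Zs F) = aggFun α λ rs →
      (List⁺.length rs ≡ List⁺.length Zs) × Sat I (update L ρ (toList Zs) (toList rs)) F

    evalArgs : Interp L → Env L → List (Arg L) → List (PTerm L)
    evalArgs I ρ [] = []
    evalArgs I ρ (a ∷ as) = evalArg I ρ a ∷ evalArgs I ρ as

    Sat : Interp L → Env L → Formula L → Set
    Sat I ρ (atom p as) = I (p , evalArgs I ρ as)
    Sat I ρ (cmp a R b) = Holds R (evalArg I ρ a) (evalArg I ρ b)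
    Sat I ρ (mem a t) = Val (substT L (λ x → just (ρ x)) t) (evalArg I ρ a)
    Sat I ρ ⊥ᶠ = ⊥
    Sat I ρ (F ⇒ G) = Sat I ρ F → Sat I ρ G
    Sat I ρ (all x F) = ∀ r → Sat I (update L ρ (x ∷ []) (r ∷ [])) F

  _⊨_ : Interp L → Inf L → Set₁
  I ⊨ atom a = Lift (lsuc 0ℓ) (I a)
  I ⊨ ⊥∞ = Lift (lsuc 0ℓ) ⊥
  I ⊨ ⋀ J f = ∀ j → I ⊨ f j
  I ⊨ ⋁ J f = Σ J λ j → I ⊨ f j
  I ⊨ (F ⊃ G) = I ⊨ F → I ⊨ G

  ⊤∞ : Inf L
  ⊤∞ = ⊥∞ ⊃ ⊥∞

  τLit : Literal L → Inf L
  τLit (pos p ts) = ⋁ (Lift _ (Σ (List (PTerm L)) (ValList ts))) λ where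
    (lift (rs , _)) → atom (p , rs)
  τLit (neg p ts) = ⋁ (Lift _ (Σ (List (PTerm L)) (ValList ts))) λ where
    (lift (rs , _)) → atom (p , rs) ⊃ ⊥∞
  -- ⊤ if r₁ ≺ r₂ for some rᵢ ∈ [tᵢ], else ⊥ (as a disjunction of ⊤ over witnesses)
  τLit (cmp t₁ R t₂) = ⋁ (Lift _ (Σ (PTerm L) λ r₁ → Σ (PTerm L) λ r₂ →
    Val t₁ r₁ × Val t₂ r₂ × Holds R r₁ r₂)) λ _ → ⊤∞

  τConj : List (Literal L) → Inf L
  τConj C = ⋀ (Lift _ (Fin (length C))) λ where
    (lift i) → τLit (List.lookup C i)

  τAgg : (E : AggExpr L) → Closed L E → Inf L
  τAgg E (s , _) =
    ⋀ (Σ (A → Set) λ Δ → ¬ Justifies Δ) λ where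
      (Δ , _) → ⋀ (Lift _ (Σ A Δ)) (λ where (lift (r , _)) → τC r)
                ⊃ ⋁ (Lift _ (Σ A λ r → ¬ Δ r)) (λ where (lift (r , _)) → τC r)
    where
      open AggExpr E
      Y : List Var
      Y = varsE L E
      A : Set
      A = Vec (PTerm L) (length Y)
      σ : A → Var → Maybe (PTerm L)
      σ r = assign L Y (Vec.toList r)
      τC : A → Inf L
      τC r = τConj (List.map (substLit L (σ r)) cond)
      ⟦_⟧ : (A → Set) → List⁺ (PTerm L) → Set
      ⟦ Δ ⟧ u = Σ A λ r → Δ r × ValList (toList (List⁺.map (substT L (σ r)) head)) (toList u)
      Justifies : (A → Set) → Set
      Justifies Δ = Holds rel (aggFun α ⟦ Δ ⟧) s

-- Both sides say that the set Δ₀ of instances of the variables of E whose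
-- conditions hold justifies E.  For τE: its conjunct for Δ = Δ₀ is exactly this
-- claim, and any other conjunct with true antecedent has Δ ⊆ Δ₀, so a false
-- consequent would force Δ = Δ₀.  For φ^X E: the set of tuples collected by the
-- aggregate is the image of Δ₀ under the head terms, because the block ∃X ranges
-- over all instances of the variables of E and, for freshly numbered bound
-- variables, φ of a literal says exactly what τ of its instance says.
module Submission where

open import Defs
open import Level using (0ℓ; Lift; lift; lower) renaming (suc to lsuc)
open import Axiom.ExcludedMiddle using (ExcludedMiddle)
open import Axiom.DoubleNegationElimination using (em⇒dne)
open import Data.Bool using (if_then_else_)
open import Data.Nat using (ℕ; suc; _+_; _⊔_; _≡ᵇ_; _<_; _≤_; s≤s)
open import Data.Nat.Properties
  using (_≟_; suc-injective; ≤-refl; ≤-trans; n≤1+n; m≤m+n; m≤m⊔n; m≤n⊔m; <⇒≱; <⇒≢; 1+n≢n;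
         +-cancelˡ-≡)
open import Data.List as List using (List; []; _∷_; length; _++_)
open import Data.List.Properties using (length-map; map-cong-local; length-applyUpTo; ∷-injectiveˡ; ∷-injectiveʳ)
open import Data.List.NonEmpty as List⁺ using (List⁺; _∷_; toList)
open import Data.List.Relation.Unary.All as All using (All; []; _∷_)
open import Data.List.Relation.Unary.All.Properties using (map⁺; map⁻; All¬⇒¬Any)
open import Data.List.Relation.Unary.Any as Any using (here; there)
open import Data.List.Relation.Unary.Any.Properties using (applyUpTo⁻)
open import Data.List.Membership.Propositional using (_∈_; _∉_)
open import Data.List.Membership.Propositional.Properties
  using (∈-++⁺ˡ; ∈-++⁺ʳ; ∈-deduplicate⁺; ∈-concatMap⁺)
open import Data.List.Relation.Unary.Unique.Propositional using (Unique; []; _∷_)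
open import Data.List.Relation.Unary.Unique.Propositional.Properties using (applyUpTo⁺₁)
open import Data.Vec as Vec using (Vec)
open import Data.Vec.Properties using (toList-map; toList∘fromList; length-toList)
open import Data.Maybe using (Maybe; just; nothing; fromMaybe)
open import Data.Product using (Σ; _×_; _,_; swap)
open import Data.Product.Function.NonDependent.Propositional using (_×-⇔_)
open import Data.Product.Function.Dependent.Propositional using (Σ-⇔)
open import Data.Sum using (_⊎_; inj₁; inj₂)
open import Data.Unit using (tt)
import Data.Fin as Fin
open import Function using (_∘_; id)
open import Function.Bundles using (_⇔_; mk⇔; Equivalence)
open import Function.Construct.Identity using (↠-id)
import Function.Properties.Equivalence as ⇔
open import Function.Related.Propositional using (module EquationalReasoning; K-reflexive)
open import Relation.Binary.PropositionalEquality using (_≡_; _≢_; refl; trans; cong; cong₂; subst; subst₂)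
import Relation.Binary.PropositionalEquality as ≡
open import Relation.Nullary using (¬_; yes; no)
open import Relation.Nullary.Decidable using (True; toWitness; fromWitness; dec-true; dec-false)

open Equivalence using (to; from)

if-≡ᵇ-same : ∀ {a} {A : Set a} x (u v : A) → (if x ≡ᵇ x then u else v) ≡ u
if-≡ᵇ-same x u v rewrite dec-true (x ≟ x) refl = refl

if-≡ᵇ-different : ∀ {a} {A : Set a} {x y} (u v : A) → x ≢ y → (if x ≡ᵇ y then u else v) ≡ v
if-≡ᵇ-different {x = x} {y} u v x≢y rewrite dec-false (x ≟ y) x≢y = refl

≤-foldr-⊔ : ∀ {y} ys → y ∈ ys → y ≤ List.foldr _⊔_ 0 ys
≤-foldr-⊔ (z ∷ zs) (here refl) = m≤m⊔n z _
≤-foldr-⊔ (z ∷ zs) (there y∈) = ≤-trans (≤-foldr-⊔ zs y∈) (m≤n⊔m z _)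

All-⇔ : ∀ {a p q} {A : Set a} {P : A → Set p} {Q : A → Set q} {xs : List A} →
  (∀ {x} → x ∈ xs → P x ⇔ Q x) → All P xs ⇔ All Q xs
All-⇔ P⇔Q = mk⇔ (λ ps → All.tabulate λ x∈ → to (P⇔Q x∈) (All.lookup ps x∈))
                (λ qs → All.tabulate λ x∈ → from (P⇔Q x∈) (All.lookup qs x∈))

range-≥ : ∀ L b n {y} → y ∈ range L b n → b ≤ y
range-≥ L b n y∈ with applyUpTo⁻ (b +_) y∈
... | i , _ , refl = m≤m+n b i

range-unique : ∀ L b n → Unique (range L b n)
range-unique L b n = applyUpTo⁺₁ (b +_) n (λ i<j _ → <⇒≢ i<j ∘ +-cancelˡ-≡ b _ _)

module _ {L : Lang} where

  update-head : ∀ (ρ : Env L) x xs v vs → update L ρ (x ∷ xs) (v ∷ vs) x ≡ v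
  update-head ρ x xs v vs = if-≡ᵇ-same x v _

  update-∉ : ∀ (ρ : Env L) xs vs {y} → y ∉ xs → update L ρ xs vs y ≡ ρ y
  update-∉ ρ []       vs       y∉ = refl
  update-∉ ρ (x ∷ xs) []       y∉ = refl
  update-∉ ρ (x ∷ xs) (v ∷ vs) y∉ =
    trans (if-≡ᵇ-different v _ (y∉ ∘ here)) (update-∉ ρ xs vs (y∉ ∘ there))

  map-update : ∀ (ρ : Env L) {xs vs} → Unique xs → length vs ≡ length xs → List.map (update L ρ xs vs) xs ≡ vs
  map-update ρ {[]}     {[]}     _                  _   = refl
  map-update ρ {x ∷ xs} {v ∷ vs} (x≢xs ∷ xs-unique) len = cong₂ _∷_ (update-head ρ x xs v vs)
    (trans (map-cong-local (All.map (λ x≢y → if-≡ᵇ-different v _ (x≢y ∘ ≡.sym)) x≢xs))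
           (map-update ρ xs-unique (suc-injective len)))

  -- Iterated single updates, as produced by a quantifier block ∃*; update is simultaneous.
  updates : Env L → List Var → List (PTerm L) → Env L
  updates ρ (x ∷ xs) (v ∷ vs) = updates (update L ρ (x ∷ []) (v ∷ [])) xs vs
  updates ρ _        _        = ρ

  updates-∉ : ∀ (ρ : Env L) xs vs {y} → y ∉ xs → updates ρ xs vs y ≡ ρ y
  updates-∉ ρ []       vs       y∉ = refl
  updates-∉ ρ (x ∷ xs) []       y∉ = refl
  updates-∉ ρ (x ∷ xs) (v ∷ vs) y∉ =
    trans (updates-∉ _ xs vs (y∉ ∘ there)) (if-≡ᵇ-different v _ (y∉ ∘ here))

  updates-below : ∀ (ρ : Env L) xs vs {b y} → (∀ {x} → x ∈ xs → b ≤ x) → y < b → updates ρ xs vs y ≡ ρ y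
  updates-below ρ xs vs fresh y<b = updates-∉ ρ xs vs (λ y∈ → <⇒≱ y<b (fresh y∈))

  map-updates : ∀ (ρ : Env L) {xs vs} → Unique xs → length vs ≡ length xs → List.map (updates ρ xs vs) xs ≡ vs
  map-updates ρ {[]}     {[]}     _                  _   = refl
  map-updates ρ {x ∷ xs} {v ∷ vs} (x≢xs ∷ xs-unique) len = cong₂ _∷_
    (trans (updates-∉ _ xs vs (All¬⇒¬Any x≢xs)) (if-≡ᵇ-same x v _))
    (map-updates _ xs-unique (suc-injective len))

  updates-map : ∀ (ρ : Env L) xs f {y} → y ∈ xs ⊎ ρ y ≡ f y → updates ρ xs (List.map f xs) y ≡ f y
  updates-map ρ []       f (inj₂ ρy≡fy) = ρy≡fy
  updates-map ρ (x ∷ xs) f {y} y∈⊎≡ = updates-map _ xs f (step y∈⊎≡)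
    where
    step : y ∈ x ∷ xs ⊎ ρ y ≡ f y → y ∈ xs ⊎ update L ρ (x ∷ []) (f x ∷ []) y ≡ f y
    step (inj₁ (here refl))  = inj₂ (if-≡ᵇ-same y (f y) _)
    step (inj₁ (there y∈xs)) = inj₁ y∈xs
    step (inj₂ ρy≡fy) with y ≟ x
    ... | yes refl = inj₂ (if-≡ᵇ-same y (f y) _)
    ... | no y≢x   = inj₂ (trans (if-≡ᵇ-different (f x) _ y≢x) ρy≡fy)

  assign-map : ∀ ys (f : Var → PTerm L) {y} → y ∈ ys → assign L ys (List.map f ys) y ≡ just (f y)
  assign-map (z ∷ zs) f {y} y∈ with y ≟ z
  ... | yes refl = if-≡ᵇ-same y _ _
  ... | no y≢z   = trans (if-≡ᵇ-different _ _ y≢z) (assign-map zs f (Any.tail y≢z y∈))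

  assign-∈ : ∀ ys (rs : List (PTerm L)) d {y} → y ∈ ys → length rs ≡ length ys →
    just (fromMaybe d (assign L ys rs y)) ≡ assign L ys rs y
  assign-∈ (z ∷ zs) (r ∷ rs) d {y} y∈ len with y ≟ z
  ... | yes refl rewrite if-≡ᵇ-same y (just r) (assign L zs rs y) = refl
  ... | no y≢z   rewrite if-≡ᵇ-different (just r) (assign L zs rs y) y≢z =
    assign-∈ zs rs d (Any.tail y≢z y∈) (suc-injective len)

  ∃updates⇔∃assign : ∀ {q} (ρ : Env L) X ys → (∀ {y} → y ∈ ys → y ∈ X) →
    (Q : (Var → Maybe (PTerm L)) → Set q) →
    (∀ {θ θ′} → (∀ {y} → y ∈ ys → θ y ≡ θ′ y) → Q θ → Q θ′) →
    Σ (List (PTerm L)) (λ vs → length vs ≡ length X × Q (just ∘ updates ρ X vs))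
      ⇔ Σ (Vec (PTerm L) (length ys)) (Q ∘ assign L ys ∘ Vec.toList)
  ∃updates⇔∃assign ρ X ys ys⊆X Q Q-resp = mk⇔ forward backward
    where
    Updates Assigns : Set _
    Updates = Σ _ λ vs → length vs ≡ length X × Q (just ∘ updates ρ X vs)
    Assigns = Σ _ (Q ∘ assign L ys ∘ Vec.toList)
    forward : Updates → Assigns
    forward (vs , _ , q) = r , Q-resp agree q
      where
      r : Vec (PTerm L) (length ys)
      r = Vec.map (updates ρ X vs) (Vec.fromList ys)
      r≡ : Vec.toList r ≡ List.map (updates ρ X vs) ys
      r≡ = trans (toList-map _ (Vec.fromList ys)) (cong (List.map _) (toList∘fromList ys))
      agree : ∀ {y} → y ∈ ys → just (updates ρ X vs y) ≡ assign L ys (Vec.toList r) y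
      agree {y} y∈ = ≡.sym (trans (cong (λ rs → assign L ys rs y) r≡) (assign-map ys _ y∈))
    backward : Assigns → Updates
    backward (r , q) = vs , length-map _ X , Q-resp agree q
      where
      θ : Var → Maybe (PTerm L)
      θ = assign L ys (Vec.toList r)
      vs : List (PTerm L)
      vs = List.map (fromMaybe inf ∘ θ) X
      agree : ∀ {y} → y ∈ ys → θ y ≡ just (updates ρ X vs y)
      agree y∈ = trans (≡.sym (assign-∈ ys (Vec.toList r) inf y∈ (length-toList r)))
                       (cong just (≡.sym (updates-map ρ X _ (inj₁ (ys⊆X y∈)))))

  mutual
    substT-cong : ∀ θ₁ θ₂ t → (∀ {x} → x ∈ varsTerm L t → θ₁ x ≡ θ₂ x) →
      substT L θ₁ t ≡ substT L θ₂ t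
    substT-cong θ₁ θ₂ (var x) agree with θ₁ x | θ₂ x | agree (here refl)
    ... | just r  | _ | refl = refl
    ... | nothing | _ | refl = refl
    substT-cong θ₁ θ₂ (num n) agree = refl
    substT-cong θ₁ θ₂ (sym c) agree = refl
    substT-cong θ₁ θ₂ inf agree = refl
    substT-cong θ₁ θ₂ sup agree = refl
    substT-cong θ₁ θ₂ (app f ts) agree = cong (app f) (substTs-cong θ₁ θ₂ ts agree)
    substT-cong θ₁ θ₂ (op o ts) agree = cong (op o) (substTs-cong θ₁ θ₂ ts agree)
    substT-cong θ₁ θ₂ (interval t₁ t₂) agree = cong₂ interval
      (substT-cong θ₁ θ₂ t₁ (agree ∘ ∈-++⁺ˡ))
      (substT-cong θ₁ θ₂ t₂ (agree ∘ ∈-++⁺ʳ (varsTerm L t₁)))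

    substTs-cong : ∀ θ₁ θ₂ ts → (∀ {x} → x ∈ varsTerms L ts → θ₁ x ≡ θ₂ x) →
      substTs L θ₁ ts ≡ substTs L θ₂ ts
    substTs-cong θ₁ θ₂ []       agree = refl
    substTs-cong θ₁ θ₂ (t ∷ ts) agree = cong₂ _∷_
      (substT-cong θ₁ θ₂ t (agree ∘ ∈-++⁺ˡ)) (substTs-cong θ₁ θ₂ ts (agree ∘ ∈-++⁺ʳ (varsTerm L t)))

  substLit-cong : ∀ θ₁ θ₂ l → (∀ {x} → x ∈ varsLit L l → θ₁ x ≡ θ₂ x) →
    substLit L θ₁ l ≡ substLit L θ₂ l
  substLit-cong θ₁ θ₂ (pos p ts) agree = cong (pos p) (substTs-cong θ₁ θ₂ ts agree)
  substLit-cong θ₁ θ₂ (neg p ts) agree = cong (neg p) (substTs-cong θ₁ θ₂ ts agree)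
  substLit-cong θ₁ θ₂ (cmp t₁ R t₂) agree = cong₂ (λ t₁′ t₂′ → cmp t₁′ R t₂′)
    (substT-cong θ₁ θ₂ t₁ (agree ∘ ∈-++⁺ˡ))
    (substT-cong θ₁ θ₂ t₂ (agree ∘ ∈-++⁺ʳ (varsTerm L t₁)))

  mutual
    substT-⌜⌝ : ∀ θ r → substT L θ (⌜_⌝ L r) ≡ ⌜_⌝ L r
    substT-⌜⌝ θ (num n) = refl
    substT-⌜⌝ θ (sym c) = refl
    substT-⌜⌝ θ inf = refl
    substT-⌜⌝ θ sup = refl
    substT-⌜⌝ θ (app f rs) = cong (app f) (substTs-⌜⌝* θ rs)

    substTs-⌜⌝* : ∀ θ rs → substTs L θ (⌜_⌝* L rs) ≡ ⌜_⌝* L rs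
    substTs-⌜⌝* θ []       = refl
    substTs-⌜⌝* θ (r ∷ rs) = cong₂ _∷_ (substT-⌜⌝ θ r) (substTs-⌜⌝* θ rs)

  substTs≡map : ∀ θ ts → substTs L θ ts ≡ List.map (substT L θ) ts
  substTs≡map θ []       = refl
  substTs≡map θ (t ∷ ts) = cong (substT L θ t ∷_) (substTs≡map θ ts)

  length-substTs : ∀ θ ts → length (substTs L θ ts) ≡ length ts
  length-substTs θ ts = trans (cong length (substTs≡map θ ts)) (length-map _ ts)

module _ {L : Lang} (M : Sem L) where

  mutual
    ⌜⌝-value⁻ : ∀ r {v} → Val M (⌜_⌝ L r) v → v ≡ r
    ⌜⌝-value⁻ (num n) v≡ = v≡
    ⌜⌝-value⁻ (sym c) v≡ = v≡
    ⌜⌝-value⁻ inf v≡ = v≡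
    ⌜⌝-value⁻ sup v≡ = v≡
    ⌜⌝-value⁻ (app f rs) (rs′ , values , v≡) = trans v≡ (cong (app f) (⌜⌝*-values⁻ rs values))

    ⌜⌝*-values⁻ : ∀ rs {rs′} → ValList M (⌜_⌝* L rs) rs′ → rs′ ≡ rs
    ⌜⌝*-values⁻ []       {[]}      _                = refl
    ⌜⌝*-values⁻ (r ∷ rs) {r′ ∷ rs′} (value , values) =
      cong₂ _∷_ (⌜⌝-value⁻ r value) (⌜⌝*-values⁻ rs values)

  mutual
    ⌜⌝-value⁺ : ∀ r → Val M (⌜_⌝ L r) r
    ⌜⌝-value⁺ (num n) = refl
    ⌜⌝-value⁺ (sym c) = refl
    ⌜⌝-value⁺ inf = refl
    ⌜⌝-value⁺ sup = refl
    ⌜⌝-value⁺ (app f rs) = rs , ⌜⌝*-values⁺ rs , refl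

    ⌜⌝*-values⁺ : ∀ rs → ValList M (⌜_⌝* L rs) rs
    ⌜⌝*-values⁺ []       = tt
    ⌜⌝*-values⁺ (r ∷ rs) = ⌜⌝-value⁺ r , ⌜⌝*-values⁺ rs

  length-ValList : ∀ ts rs → ValList M ts rs → length rs ≡ length ts
  length-ValList []       []       _            = refl
  length-ValList (t ∷ ts) (r ∷ rs) (_ , values) = cong suc (length-ValList ts rs values)

module _ {L : Lang} (M : Sem L) (em : ExcludedMiddle (lsuc 0ℓ)) (I : Interp L) where
  open Sem M using (aggFun; aggFun-ext)

  private
    PT : Set
    PT = PTerm L

  infix 4 _⊩_ ⊨_

  _⊩_ : Env L → Formula L → Set
  ρ ⊩ F = Sat M I ρ F

  ⊨_ : Inf L → Set₁
  ⊨ F = _⊨_ M I F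

  dne : {P : Set} → ¬ ¬ P → P
  dne ¬¬p = lower (em⇒dne em λ ¬p → ¬¬p (¬p ∘ lift))

  -- The sets Δ in τE are Set-valued while satisfaction lives in Set₁;
  -- excluded middle bridges the gap.
  ⌊_⌋ : Set₁ → Set
  ⌊ P ⌋ = True (em {P})

  ⌊⌋⇔ : ∀ {P} → ⌊ P ⌋ ⇔ P
  ⌊⌋⇔ = mk⇔ toWitness fromWitness

  Sat-∃ᶠ : ∀ ρ x F → ρ ⊩ ∃ᶠ L x F ⇔ Σ PT λ v → update L ρ (x ∷ []) (v ∷ []) ⊩ F
  Sat-∃ᶠ ρ x F = mk⇔ (λ ¬∀¬ → dne λ ∄ → ¬∀¬ λ v sat → ∄ (v , sat))
                     (λ (v , sat) ∀¬ → ∀¬ v sat)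

  Sat-∧ᶠ : ∀ ρ F G → ρ ⊩ _∧ᶠ_ L F G ⇔ (ρ ⊩ F × ρ ⊩ G)
  Sat-∧ᶠ ρ F G = mk⇔ (λ ¬→¬ → dne (λ ¬f → ¬→¬ λ f _ → ¬f f) , dne (λ ¬g → ¬→¬ λ _ g → ¬g g))
                     (λ (f , g) f→¬g → f→¬g f g)

  Sat-⋀ᶠ : ∀ ρ Fs → ρ ⊩ ⋀ᶠ L Fs ⇔ All (ρ ⊩_) Fs
  Sat-⋀ᶠ ρ []           = mk⇔ (λ _ → []) (λ _ → id)
  Sat-⋀ᶠ ρ (F ∷ [])     = mk⇔ (_∷ []) All.head
  Sat-⋀ᶠ ρ (F ∷ G ∷ Gs) = ⇔.trans (Sat-∧ᶠ ρ F (⋀ᶠ L (G ∷ Gs))) (∷⇔ (Sat-⋀ᶠ ρ (G ∷ Gs)))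
    where
    ∷⇔ : ρ ⊩ ⋀ᶠ L (G ∷ Gs) ⇔ All (ρ ⊩_) (G ∷ Gs) →
         (ρ ⊩ F × ρ ⊩ ⋀ᶠ L (G ∷ Gs)) ⇔ All (ρ ⊩_) (F ∷ G ∷ Gs)
    ∷⇔ ⊩Gs⇔ = mk⇔ (λ (f , gs) → f ∷ to ⊩Gs⇔ gs) (λ all → All.head all , from ⊩Gs⇔ (All.tail all))

  Sat-∃* : ∀ ρ xs F → ρ ⊩ ∃* L xs F ⇔ Σ (List PT) λ vs → length vs ≡ length xs × updates ρ xs vs ⊩ F
  Sat-∃* ρ []       F = mk⇔ (λ sat → [] , refl , sat) (λ { ([] , _ , sat) → sat })
  Sat-∃* ρ (x ∷ xs) F = ⇔.trans (Sat-∃ᶠ ρ x (∃* L xs F)) (mk⇔ forward backward)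
    where
    forward : Σ PT (λ v → update L ρ (x ∷ []) (v ∷ []) ⊩ ∃* L xs F) →
      Σ (List PT) λ vs → length vs ≡ length (x ∷ xs) × updates ρ (x ∷ xs) vs ⊩ F
    forward (v , sat) with to (Sat-∃* _ xs F) sat
    ... | vs , len , sat′ = v ∷ vs , cong suc len , sat′
    backward : (Σ (List PT) λ vs → length vs ≡ length (x ∷ xs) × updates ρ (x ∷ xs) vs ⊩ F) →
      Σ PT (λ v → update L ρ (x ∷ []) (v ∷ []) ⊩ ∃* L xs F)
    backward (v ∷ vs , len , sat) = v , from (Sat-∃* _ xs F) (vs , suc-injective len , sat)

  Sat-memT : ∀ ρ xs ts → length xs ≡ length ts →
    ρ ⊩ memT L xs ts ⇔ ValList M (substTs L (just ∘ ρ) ts) (List.map ρ xs)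
  Sat-memT ρ xs ts len = ⇔.trans (Sat-⋀ᶠ ρ _) (mk⇔ (forward xs ts len) (backward xs ts len))
    where
    forward : ∀ xs ts → length xs ≡ length ts → All (ρ ⊩_) (List.zipWith (λ x t → mem (var x) t) xs ts) →
      ValList M (substTs L (just ∘ ρ) ts) (List.map ρ xs)
    forward []       []       _   []       = tt
    forward (x ∷ xs) (t ∷ ts) len (m ∷ ms) = m , forward xs ts (suc-injective len) ms
    backward : ∀ xs ts → length xs ≡ length ts → ValList M (substTs L (just ∘ ρ) ts) (List.map ρ xs) →
      All (ρ ⊩_) (List.zipWith (λ x t → mem (var x) t) xs ts)
    backward []       []       _   _        = []
    backward (x ∷ xs) (t ∷ ts) len (m , ms) = m ∷ backward xs ts (suc-injective len) ms

  ⊨τConj⇔All : ∀ C → ⊨ τConj M C ⇔ All (⊨_ ∘ τLit M) C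
  ⊨τConj⇔All C = mk⇔ (forward C) (backward C)
    where
    forward : ∀ C → ⊨ τConj M C → All (⊨_ ∘ τLit M) C
    forward []      _   = []
    forward (l ∷ C) ⊨lC = ⊨lC (lift Fin.zero) ∷ forward C (⊨lC ∘ lift ∘ Fin.suc ∘ lower)
    backward : ∀ C → All (⊨_ ∘ τLit M) C → ⊨ τConj M C
    backward (l ∷ C) (⊨l ∷ _)  (lift Fin.zero)    = ⊨l
    backward (l ∷ C) (_  ∷ ⊨C) (lift (Fin.suc i)) = backward C ⊨C (lift i)

  evalArgs-var : ∀ ρ xs → evalArgs M I ρ (List.map var xs) ≡ List.map ρ xs
  evalArgs-var ρ []       = refl
  evalArgs-var ρ (x ∷ xs) = cong (ρ x ∷_) (evalArgs-var ρ xs)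

  module _ (ρ : Env L) (b : ℕ) where

    substT-updates-fresh : ∀ xs vs → (∀ {x} → x ∈ xs → b ≤ x) →
      ∀ t → (∀ {y} → y ∈ varsTerm L t → y < b) →
      substT L (just ∘ updates ρ xs vs) t ≡ substT L (just ∘ ρ) t
    substT-updates-fresh xs vs fresh t bound =
      substT-cong _ _ t λ y∈ → cong just (updates-below ρ xs vs fresh (bound y∈))

    substTs-updates-fresh : ∀ xs vs → (∀ {x} → x ∈ xs → b ≤ x) →
      ∀ ts → (∀ {y} → y ∈ varsTerms L ts → y < b) →
      substTs L (just ∘ updates ρ xs vs) ts ≡ substTs L (just ∘ ρ) ts
    substTs-updates-fresh xs vs fresh ts bound =
      substTs-cong _ _ ts λ y∈ → cong just (updates-below ρ xs vs fresh (bound y∈))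

    Sat-∃range-memT : ∀ ts G (P : List PT → Set) → (∀ {y} → y ∈ varsTerms L ts → y < b) →
      (∀ ρ′ → ρ′ ⊩ G ⇔ P (List.map ρ′ (range L b (length ts)))) →
      let xs = range L b (length ts) in
      ρ ⊩ ∃* L xs (_∧ᶠ_ L (memT L xs ts) G)
        ⇔ Σ (List PT) λ rs → ValList M (substTs L (just ∘ ρ) ts) rs × P rs
    Sat-∃range-memT ts G P bound G⇔P = ⇔.trans (Sat-∃* ρ xs _) (mk⇔ forward backward)
      where
      xs : List Var
      xs = range L b (length ts)
      length-xs : length xs ≡ length ts
      length-xs = length-applyUpTo (b +_) (length ts)
      forward : (Σ (List PT) λ vs → length vs ≡ length xs × updates ρ xs vs ⊩ _∧ᶠ_ L (memT L xs ts) G) →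
        Σ (List PT) λ rs → ValList M (substTs L (just ∘ ρ) ts) rs × P rs
      forward (vs , _ , sat) with to (Sat-∧ᶠ (updates ρ xs vs) (memT L xs ts) G) sat
      ... | ⊩mem , ⊩G = List.map (updates ρ xs vs) xs
        , subst (λ ts′ → ValList M ts′ (List.map (updates ρ xs vs) xs))
                (substTs-updates-fresh xs vs (range-≥ L b (length ts)) ts bound)
                (to (Sat-memT _ xs ts length-xs) ⊩mem)
        , to (G⇔P _) ⊩G
      backward : (Σ (List PT) λ rs → ValList M (substTs L (just ∘ ρ) ts) rs × P rs) →
        Σ (List PT) λ vs → length vs ≡ length xs × updates ρ xs vs ⊩ _∧ᶠ_ L (memT L xs ts) G
      backward (rs , values , p) =
        rs , length-rs , from (Sat-∧ᶠ _ (memT L xs ts) G) (⊩mem , from (G⇔P _) (subst P (≡.sym xs↦rs) p))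
        where
        length-rs : length rs ≡ length xs
        length-rs = trans (length-ValList M _ rs values) (trans (length-substTs (just ∘ ρ) ts) (≡.sym length-xs))
        xs↦rs : List.map (updates ρ xs rs) xs ≡ rs
        xs↦rs = map-updates ρ (range-unique L b (length ts)) length-rs
        ⊩mem : updates ρ xs rs ⊩ memT L xs ts
        ⊩mem = from (Sat-memT _ xs ts length-xs) (subst₂ (ValList M)
          (≡.sym (substTs-updates-fresh xs rs (range-≥ L b (length ts)) ts bound)) (≡.sym xs↦rs) values)

    Sat-φcmp : ∀ t₁ R t₂ →
      (∀ {y} → y ∈ varsTerm L t₁ → y < b) → (∀ {y} → y ∈ varsTerm L t₂ → y < b) →
      ρ ⊩ φLit L b (cmp t₁ R t₂) ⇔ ⊨ τLit M (cmp (substT L (just ∘ ρ) t₁) R (substT L (just ∘ ρ) t₂))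
    Sat-φcmp t₁ R t₂ bound₁ bound₂ = ⇔.trans (Sat-∃* ρ xs G) (mk⇔ forward backward)
      where
      xs : List Var
      xs = b ∷ suc b ∷ []
      fresh : ∀ {x} → x ∈ xs → b ≤ x
      fresh (here refl)         = ≤-refl
      fresh (there (here refl)) = n≤1+n b
      mem₁ mem₂ cmp₁₂ G₂ G : Formula L
      mem₁  = mem (var b) t₁
      mem₂  = mem (var (suc b)) t₂
      cmp₁₂ = cmp (var b) R (var (suc b))
      G₂    = _∧ᶠ_ L mem₂ cmp₁₂
      G     = _∧ᶠ_ L mem₁ G₂
      unchanged : ∀ vs t → (∀ {y} → y ∈ varsTerm L t → y < b) →
        substT L (just ∘ updates ρ xs vs) t ≡ substT L (just ∘ ρ) t
      unchanged vs = substT-updates-fresh xs vs fresh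
      forward : (Σ (List PT) λ vs → length vs ≡ length xs × updates ρ xs vs ⊩ G) →
        ⊨ τLit M (cmp (substT L (just ∘ ρ) t₁) R (substT L (just ∘ ρ) t₂))
      forward (vs , _ , sat) with to (Sat-∧ᶠ _ mem₁ G₂) sat
      ... | ⊩mem₁ , sat′ with to (Sat-∧ᶠ _ mem₂ cmp₁₂) sat′
      ... | ⊩mem₂ , holds = lift ( updates ρ xs vs b , updates ρ xs vs (suc b)
                                 , subst (λ t → Val M t _) (unchanged vs t₁ bound₁) ⊩mem₁
                                 , subst (λ t → Val M t _) (unchanged vs t₂ bound₂) ⊩mem₂
                                 , holds ) , id
      backward : ⊨ τLit M (cmp (substT L (just ∘ ρ) t₁) R (substT L (just ∘ ρ) t₂)) →
        Σ (List PT) λ vs → length vs ≡ length xs × updates ρ xs vs ⊩ G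
      backward (lift (r₁ , r₂ , value₁ , value₂ , holds) , _) = rs , refl ,
        from (Sat-∧ᶠ _ mem₁ G₂) (subst₂ (Val M) (≡.sym (unchanged rs t₁ bound₁)) (≡.sym b↦r₁) value₁ ,
        from (Sat-∧ᶠ _ mem₂ cmp₁₂)
          (subst₂ (Val M) (≡.sym (unchanged rs t₂ bound₂)) (≡.sym sb↦r₂) value₂ ,
                                     subst₂ (Holds M R) (≡.sym b↦r₁) (≡.sym sb↦r₂) holds))
        where
        rs : List PT
        rs = r₁ ∷ r₂ ∷ []
        xs↦rs : List.map (updates ρ xs rs) xs ≡ rs
        xs↦rs = map-updates ρ (((1+n≢n {b} ∘ ≡.sym) ∷ []) ∷ [] ∷ []) refl
        b↦r₁ : updates ρ xs rs b ≡ r₁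
        b↦r₁ = ∷-injectiveˡ xs↦rs
        sb↦r₂ : updates ρ xs rs (suc b) ≡ r₂
        sb↦r₂ = ∷-injectiveˡ (∷-injectiveʳ xs↦rs)

    Sat-φLit : ∀ l → (∀ {y} → y ∈ varsLit L l → y < b) →
      ρ ⊩ φLit L b l ⇔ ⊨ τLit M (substLit L (just ∘ ρ) l)
    Sat-φLit (pos p ts) bound = ⇔.trans (Sat-∃range-memT ts _ (λ rs → I (p , rs)) bound atom⇔)
      (mk⇔ (λ (rs , values , a) → lift (rs , values) , lift a)
           (λ (lift (rs , values) , lift a) → rs , values , a))
      where
      atom⇔ : ∀ ρ′ → ρ′ ⊩ atom p (List.map var (range L b (length ts)))
                   ⇔ I (p , List.map ρ′ (range L b (length ts)))
      atom⇔ ρ′ = K-reflexive (cong (λ rs → I (p , rs)) (evalArgs-var ρ′ _))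
    Sat-φLit (neg p ts) bound = ⇔.trans (Sat-∃range-memT ts _ (λ rs → ¬ I (p , rs)) bound ¬atom⇔)
      (mk⇔ (λ (rs , values , ¬a) → lift (rs , values) , lift ∘ ¬a ∘ lower)
           (λ (lift (rs , values) , ¬a) → rs , values , lower ∘ ¬a ∘ lift))
      where
      ¬atom⇔ : ∀ ρ′ → ρ′ ⊩ ¬ᶠ_ L (atom p (List.map var (range L b (length ts))))
                    ⇔ (¬ I (p , List.map ρ′ (range L b (length ts))))
      ¬atom⇔ ρ′ = K-reflexive (cong (λ rs → ¬ I (p , rs)) (evalArgs-var ρ′ _))
    Sat-φLit (cmp t₁ R t₂) bound = Sat-φcmp t₁ R t₂ (bound ∘ ∈-++⁺ˡ) (bound ∘ ∈-++⁺ʳ (varsTerm L t₁))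

    Sat-φConj : ∀ C → (∀ {l} → l ∈ C → ∀ {y} → y ∈ varsLit L l → y < b) →
      ρ ⊩ φConj L b C ⇔ ⊨ τConj M (List.map (substLit L (just ∘ ρ)) C)
    Sat-φConj C bound = begin
      ρ ⊩ φConj L b C                                            ∼⟨ Sat-⋀ᶠ ρ (List.map (φLit L b) C) ⟩
      All (ρ ⊩_) (List.map (φLit L b) C)                          ∼⟨ mk⇔ map⁻ map⁺ ⟩
      All (λ l → ρ ⊩ φLit L b l) C                               ∼⟨ All-⇔ (λ l∈ → Sat-φLit _ (bound l∈)) ⟩
      All (λ l → ⊨ τLit M (substLit L (just ∘ ρ) l)) C            ∼⟨ mk⇔ map⁺ map⁻ ⟩
      All (⊨_ ∘ τLit M) (List.map (substLit L (just ∘ ρ)) C)     ∼⟨ ⇔.sym (⊨τConj⇔All _) ⟩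
      ⊨ τConj M (List.map (substLit L (just ∘ ρ)) C)             ∎
      where open EquationalReasoning

  module _ {A : Set} (F : A → Inf L) (Justifies : (A → Set) → Set)
           (Justifies-resp : ∀ {Δ Δ′} → (∀ r → Δ r ⇔ Δ′ r) → Justifies Δ → Justifies Δ′) where

    -- τE, with F r standing for τ(C^Y_r).
    ⋀unjustified : Inf L
    ⋀unjustified = ⋀ (Σ (A → Set) λ Δ → ¬ Justifies Δ) λ (Δ , _) →
      ⋀ (Lift _ (Σ A Δ)) (λ (lift (r , _)) → F r) ⊃ ⋁ (Lift _ (Σ A λ r → ¬ Δ r)) (λ (lift (r , _)) → F r)

    ⊨⋀unjustified⇔ : (Δ₀ : A → Set) → (∀ r → Δ₀ r ⇔ ⊨ F r) → ⊨ ⋀unjustified ⇔ Justifies Δ₀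
    ⊨⋀unjustified⇔ Δ₀ Δ₀⇔ = mk⇔ forward backward
      where
      forward : ⊨ ⋀unjustified → Justifies Δ₀
      forward ⊨⋀ = dne λ ¬J₀ →
        let (lift (r , r∉Δ₀) , ⊨Fr) = ⊨⋀ (Δ₀ , ¬J₀) (λ (lift (r , r∈Δ₀)) → to (Δ₀⇔ r) r∈Δ₀)
        in r∉Δ₀ (from (Δ₀⇔ r) ⊨Fr)
      backward : Justifies Δ₀ → ⊨ ⋀unjustified
      backward J₀ (Δ , ¬J) ⊨Δ = em⇒dne em λ ¬⊨⋁ →
        ¬J (Justifies-resp (λ r → mk⇔ (Δ₀⊆Δ ¬⊨⋁ r) (Δ⊆Δ₀ r)) J₀)
        where
        Δ⊆Δ₀ : ∀ r → Δ r → Δ₀ r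
        Δ⊆Δ₀ r r∈Δ = from (Δ₀⇔ r) (⊨Δ (lift (r , r∈Δ)))
        Δ₀⊆Δ : ¬ (Σ (Lift _ (Σ A λ r → ¬ Δ r)) λ (lift (r , _)) → ⊨ F r) → ∀ r → Δ₀ r → Δ r
        Δ₀⊆Δ ¬⊨⋁ r r∈Δ₀ = dne λ r∉Δ → ¬⊨⋁ (lift (r , r∉Δ) , to (Δ₀⇔ r) r∈Δ₀)

  Sat-∃-cmp-mem : ∀ ρ y a R s c → (∀ ρ′ → evalArg M I ρ′ a ≡ c) →
    ρ ⊩ ∃ᶠ L y (_∧ᶠ_ L (cmp a R (var y)) (mem (var y) (⌜_⌝ L s))) ⇔ Holds M R c s
  Sat-∃-cmp-mem ρ y a R s c a≡c = ⇔.trans (Sat-∃ᶠ ρ y G) (mk⇔ forward backward)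
    where
    G : Formula L
    G = _∧ᶠ_ L (cmp a R (var y)) (mem (var y) (⌜_⌝ L s))
    forward : Σ PT (λ v → update L ρ (y ∷ []) (v ∷ []) ⊩ G) → Holds M R c s
    forward (v , sat) with to (Sat-∧ᶠ _ (cmp a R (var y)) (mem (var y) (⌜_⌝ L s))) sat
    ... | holds , value = subst₂ (Holds M R) (a≡c _)
      (⌜⌝-value⁻ M s (subst (λ t → Val M t _) (substT-⌜⌝ _ s) value)) holds
    backward : Holds M R c s → Σ PT (λ v → update L ρ (y ∷ []) (v ∷ []) ⊩ G)
    backward holds = s , from (Sat-∧ᶠ _ (cmp a R (var y)) (mem (var y) (⌜_⌝ L s)))
      ( subst₂ (Holds M R) (≡.sym (a≡c _)) (≡.sym y↦s) holds
      , subst₂ (Val M) (≡.sym (substT-⌜⌝ _ s)) (≡.sym y↦s) (⌜⌝-value⁺ M s))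
      where
      y↦s : update L ρ (y ∷ []) (s ∷ []) y ≡ s
      y↦s = update-head ρ y [] s []

  module Aggregate (α : Lang.AggName L) (h : Term L) (hs : List (Term L)) (cond : List (Literal L))
                   (rel : Cmp) (s : PT) where

    E : AggExpr L
    E = aggExpr α (h ∷ hs) cond rel (rpre s)

    Ys : List Var
    Ys = varsE L E

    A : Set
    A = Vec PT (length Ys)

    σ : A → Var → Maybe PT
    σ r = assign L Ys (Vec.toList r)

    Instance : (Var → Maybe PT) → List⁺ PT → Set₁
    Instance θ u = ⊨ τConj M (List.map (substLit L θ) cond)
                 × ValList M (toList (List⁺.map (substT L θ) (h ∷ hs))) (toList u)

    ⟦_⟧ : (A → Set) → List⁺ PT → Set
    ⟦ Δ ⟧ u = Σ A λ r → Δ r × ValList M (toList (List⁺.map (substT L (σ r)) (h ∷ hs))) (toList u)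

    Justifies : (A → Set) → Set
    Justifies Δ = Holds M rel (aggFun α ⟦ Δ ⟧) s

    τC : A → Inf L
    τC r = τConj M (List.map (substLit L (σ r)) cond)

    Satisfied : A → Set
    Satisfied r = ⌊ ⊨ τC r ⌋

    ⟦Satisfied⟧⇔ : ∀ u → ⟦ Satisfied ⟧ u ⇔ Σ A λ r → Instance (σ r) u
    ⟦Satisfied⟧⇔ u = mk⇔ (λ (r , sat , values) → r , to ⌊⌋⇔ sat , values)
                         (λ (r , sat , values) → r , from ⌊⌋⇔ sat , values)

    Justifies-resp : ∀ {Δ Δ′} → (∀ r → Δ r ⇔ Δ′ r) → Justifies Δ → Justifies Δ′
    Justifies-resp Δ⇔Δ′ = subst (λ c → Holds M rel c s) (aggFun-ext α _ _ λ u →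
      mk⇔ (λ (r , r∈Δ , values) → r , to (Δ⇔Δ′ r) r∈Δ , values)
          (λ (r , r∈Δ′ , values) → r , from (Δ⇔Δ′ r) r∈Δ′ , values))

    τAgg⇔Justifies : ⊨ τAgg M E (s , refl) ⇔ Justifies Satisfied
    τAgg⇔Justifies = ⊨⋀unjustified⇔ τC Justifies Justifies-resp Satisfied (λ r → ⌊⌋⇔)

    head-vars : ∀ {y} → y ∈ varsTerms L (h ∷ hs) → y ∈ Ys
    head-vars y∈ = ∈-deduplicate⁺ _≟_ (∈-++⁺ˡ y∈)

    cond-vars : ∀ {l y} → l ∈ cond → y ∈ varsLit L l → y ∈ Ys
    cond-vars l∈ y∈ = ∈-deduplicate⁺ _≟_ (∈-++⁺ʳ (varsTerms L (h ∷ hs))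
      (∈-++⁺ˡ (∈-concatMap⁺ (varsLit L) (Any.map (λ { refl → y∈ }) l∈))))

    Instance-resp : ∀ {θ θ′} u → (∀ {y} → y ∈ Ys → θ y ≡ θ′ y) → Instance θ u → Instance θ′ u
    Instance-resp {θ} {θ′} u agree = subst₂ (λ C ts → ⊨ τConj M C × ValList M ts (toList u)) conds heads
      where
      conds : List.map (substLit L θ) cond ≡ List.map (substLit L θ′) cond
      conds = map-cong-local (All.tabulate λ l∈ → substLit-cong θ θ′ _ (agree ∘ cond-vars l∈))
      heads : List.map (substT L θ) (h ∷ hs) ≡ List.map (substT L θ′) (h ∷ hs)
      heads = trans (≡.sym (substTs≡map θ (h ∷ hs)))
                    (trans (substTs-cong θ θ′ (h ∷ hs) (agree ∘ head-vars)) (substTs≡map θ′ (h ∷ hs)))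

    module _ (X : List Var) (Ys⊆X : ∀ {y} → y ∈ Ys → y ∈ X) where

      -- The fresh variables chosen by φAgg.
      N : ℕ
      N = suc (List.foldr _⊔_ 0 (X ++ Ys))

      Zs : List⁺ Var
      Zs = N ∷ range L (suc N) (length hs)

      Y : Var
      Y = N + suc (length hs)

      b : ℕ
      b = suc Y

      Body : Formula L
      Body = _∧ᶠ_ L (memT L (toList Zs) (h ∷ hs)) (φConj L b cond)

      F : Formula L
      F = ∃* L X Body

      old<N : ∀ {y} → y ∈ X ++ Ys → y < N
      old<N y∈ = s≤s (≤-foldr-⊔ (X ++ Ys) y∈)

      X<N : ∀ {y} → y ∈ X → y < N
      X<N = old<N ∘ ∈-++⁺ˡ

      Ys<b : ∀ {y} → y ∈ Ys → y < b
      Ys<b y∈ = ≤-trans (old<N (∈-++⁺ʳ X y∈)) (≤-trans (m≤m+n N _) (n≤1+n _))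

      Zs-≥ : ∀ {z} → z ∈ toList Zs → N ≤ z
      Zs-≥ (here refl) = ≤-refl
      Zs-≥ (there z∈)  = ≤-trans (n≤1+n N) (range-≥ L (suc N) (length hs) z∈)

      Zs-unique : Unique (toList Zs)
      Zs-unique = All.tabulate (<⇒≢ ∘ range-≥ L (suc N) (length hs)) ∷ range-unique L (suc N) (length hs)

      length-Zs : length (toList Zs) ≡ suc (length hs)
      length-Zs = cong suc (length-applyUpTo _ (length hs))

      ⟦Satisfied⟧-length : ∀ {u} → ⟦ Satisfied ⟧ u → List⁺.length u ≡ List⁺.length Zs
      ⟦Satisfied⟧-length {u} (_ , _ , values) =
        trans (length-ValList M _ (toList u) values) (trans (cong suc (length-map _ hs)) (≡.sym length-Zs))

      ⊩F⇔ : ∀ ρ u → List⁺.length u ≡ List⁺.length Zs →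
        let ρu = update L ρ (toList Zs) (toList u) in
        ρu ⊩ F ⇔ Σ (List PT) λ vs → length vs ≡ length X × Instance (just ∘ updates ρu X vs) u
      ⊩F⇔ ρ u len = ⇔.trans (Sat-∃* ρu X Body) (Σ-⇔ (↠-id _) (⇔.refl ×-⇔ instance⇔ _))
        where
        ρu : Env L
        ρu = update L ρ (toList Zs) (toList u)
        Zs↦u : ∀ vs → List.map (updates ρu X vs) (toList Zs) ≡ toList u
        Zs↦u vs = trans
          (map-cong-local (All.tabulate λ z∈ → updates-∉ ρu X vs λ z∈X → <⇒≱ (X<N z∈X) (Zs-≥ z∈)))
          (map-update ρ Zs-unique len)
        instance⇔ : ∀ vs → updates ρu X vs ⊩ Body ⇔ Instance (just ∘ updates ρu X vs) u
        instance⇔ vs = begin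
          ρ₁ ⊩ Body
            ∼⟨ Sat-∧ᶠ ρ₁ (memT L (toList Zs) (h ∷ hs)) (φConj L b cond) ⟩
          (ρ₁ ⊩ memT L (toList Zs) (h ∷ hs) × ρ₁ ⊩ φConj L b cond)
            ∼⟨ Sat-memT ρ₁ (toList Zs) (h ∷ hs) length-Zs
                 ×-⇔ Sat-φConj ρ₁ b cond (λ l∈ → Ys<b ∘ cond-vars l∈) ⟩
          (ValList M (substTs L (just ∘ ρ₁) (h ∷ hs)) (List.map ρ₁ (toList Zs)) × ⊨ τConj M conds)
            ≡⟨ cong₂ (λ ts us → ValList M ts us × ⊨ τConj M conds) (substTs≡map _ (h ∷ hs)) (Zs↦u vs) ⟩
          (ValList M (List.map (substT L (just ∘ ρ₁)) (h ∷ hs)) (toList u) × ⊨ τConj M conds)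
            ∼⟨ mk⇔ swap swap ⟩
          Instance (just ∘ ρ₁) u
            ∎
          where
          open EquationalReasoning
          ρ₁ : Env L
          ρ₁ = updates ρu X vs
          conds : List (Literal L)
          conds = List.map (substLit L (just ∘ ρ₁)) cond

      collected⇔ : ∀ ρ u → (List⁺.length u ≡ List⁺.length Zs × update L ρ (toList Zs) (toList u) ⊩ F)
                           ⇔ ⟦ Satisfied ⟧ u
      collected⇔ ρ u = mk⇔
        (λ (len , sat) → from (⟦Satisfied⟧⇔ u) (to instances⇔ (to (⊩F⇔ ρ u len) sat)))
        (λ inst → let len = ⟦Satisfied⟧-length inst in
                  len , from (⊩F⇔ ρ u len) (from instances⇔ (to (⟦Satisfied⟧⇔ u) inst)))
        where
        ρu : Env L
        ρu = update L ρ (toList Zs) (toList u)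
        instances⇔ : Σ (List PT) (λ vs → length vs ≡ length X × Instance (just ∘ updates ρu X vs) u)
                     ⇔ Σ A λ r → Instance (σ r) u
        instances⇔ = ∃updates⇔∃assign ρu X Ys Ys⊆X (λ θ → Instance θ u) (Instance-resp u)

      φAgg⇔Justifies : ∀ ρ → ρ ⊩ φAgg L X E ⇔ Justifies Satisfied
      φAgg⇔Justifies ρ = Sat-∃-cmp-mem ρ Y (agg α Zs F) rel s _ λ ρ′ → aggFun-ext α _ _ (collected⇔ ρ′)

lemma2 : (L : Lang) (M : Sem L) → ExcludedMiddle (lsuc 0ℓ) →
    (E : AggExpr L) (cl : Closed L E) (X : List Var) → Unique X →
    (∀ {v} → v ∈ varsE L E → v ∈ X) →
    (I : Interp L) → (∀ a → I a → InVoc L E a) →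
    (ρ : Env L) → _⊨_ M I (τAgg M E cl) ⇔ Sat M I ρ (φAgg L X E)
lemma2 L M em (aggExpr α (h ∷ hs) cond rel .(rpre s)) (s , refl) X _ Ys⊆X I _ ρ =
  ⇔.trans τAgg⇔Justifies (⇔.sym (φAgg⇔Justifies X Ys⊆X ρ))
  where open Aggregate M em I α h hs cond rel s
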